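{- Let $\mathcal P$ be any set of formulas. The system $\mathrm{ML}_{\mathcal P}$ has the sub-formula property: every $\mathcal P$-sequent derivable in $\mathrm{ML}_{\mathcal P}$ has a derivation in $\mathrm{ML}_{\mathcal P}$ in which every formula occurring is a sub-formula of some formula of the conclusion sequent.
   Context: Formulas are given by the grammar $F ::= 0 \mid \perp \mid X \mid F\wedge F \mid F\vee F \mid F\rightarrow F$, where $X$ ranges over a set $\mathcal V$ of propositional variables and $0$, $\perp$ are two distinct constants. Fix an arbitrary set $\mathcal P$ of formulas. A $\mathcal P$-sequent is an expression $\Gamma\vdash\Delta;\Pi$ where $\Gamma,\Delta,\Pi$ are finite multisets of formulas, every formula of $\Delta$ (the body) belongs to $\mathcal P$, and $\Pi$ (the stoup) contains at most one formula. The system $\mathrm{ML}_{\mathcal P}$ derives $\mathcal P$-sequents with the following rules (below $C$ denotes a single formula, $\Pi$ a stoup with at most one formula, and all sequents must be $\mathcal P$-sequents): Axiom/cuts: $ax$: $A\vdash ;A$. $cut_1$: from $\Gamma\vdash\Delta;A$ and $\Gamma',A\vdash\Delta';\Pi$ infer $\Gamma,\Gamma'\vdash\Delta,\Delta';\Pi$. $cut_2$: from $\Gamma\vdash\Delta,A;\Pi$ and $\Gamma',A\vdash\Delta';$ infer $\Gamma,\Gamma'\vdash\Delta,\Delta';\Pi$. Structure: $der$: from $\Gamma\vdash\Delta;A$ with $A\in\mathcal P$ infer $\Gamma\vdash\Delta,A;$. $c_l$: from $\Gamma,A,A\vdash\Delta;\Pi$ infer $\Gamma,A\vdash\Delta;\Pi$.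 $c_r$: from $\Gamma\vdash\Delta,A,A;\Pi$ infer $\Gamma\vdash\Delta,A;\Pi$. $w_l$: from $\Gamma\vdash\Delta;\Pi$ infer $\Gamma,A\vdash\Delta;\Pi$. $w_r$: from $\Gamma\vdash\Delta;\Pi$ with $A\in\mathcal P$ infer $\Gamma\vdash\Delta,A;\Pi$. Logic: $0$: $\Gamma,0\vdash\Delta;\Pi$ (any $\Delta\subseteq\mathcal P$). $\perp$: $\perp\vdash ;$. $\wedge^1_l$: from $\Gamma,A,B\vdash\Delta;C$ with $A\notin\mathcal P$ and $B\notin\mathcal P$ infer $\Gamma,A\wedge B\vdash\Delta;C$. $\wedge^2_l$: from $\Gamma,A,B\vdash\Delta;$ infer $\Gamma,A\wedge B\vdash\Delta;$. $\wedge^1_r$: from $\Gamma\vdash\Delta;A$ and $\Gamma'\vdash\Delta';B$ infer $\Gamma,\Gamma'\vdash\Delta,\Delta';A\wedge B$. $\wedge^2_r$: from $\Gamma\vdash\Delta,A;$ and $\Gamma'\vdash\Delta',B;$ infer the same conclusion. $\wedge^3_r$: from $\Gamma\vdash\Delta;A$ and $\Gamma'\vdash\Delta',B;$ infer the same conclusion. $\wedge^4_r$: from $\Gamma\vdash\Delta,A;$ and $\Gamma'\vdash\Delta';B$ infer the same conclusion. $\vee^1_l$: from $\Gamma,A\vdash\Delta;C$ and $\Gamma,B\vdash\Delta;C$ with $A\notin\mathcal P$ and $B\notin\mathcal P$ infer $\Gamma,A\vee B\vdash\Delta;C$. $\vee^2_l$: from $\Gamma,A\vdash\Delta;$ and $\Gamma,B\vdash\Delta;$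 infer $\Gamma,A\vee B\vdash\Delta;$. $\vee^1_r$: from $\Gamma\vdash\Delta;A$ infer $\Gamma\vdash\Delta;A\vee B$. $\vee^2_r$: from $\Gamma\vdash\Delta;B$ infer $\Gamma\vdash\Delta;A\vee B$. $\vee^3_r$: from $\Gamma\vdash\Delta,A;$ infer $\Gamma\vdash\Delta;A\vee B$. $\vee^4_r$: from $\Gamma\vdash\Delta,B;$ infer $\Gamma\vdash\Delta;A\vee B$. $\rightarrow^1_l$: from $\Gamma,B\vdash\Delta;C$ and $\Gamma'\vdash\Delta';A$ with $B\notin\mathcal P$ infer $\Gamma,\Gamma',A\rightarrow B\vdash\Delta,\Delta';C$. $\rightarrow^2_l$: from $\Gamma,B\vdash\Delta;$ and $\Gamma'\vdash\Delta';A$ infer $\Gamma,\Gamma',A\rightarrow B\vdash\Delta,\Delta';$. $\rightarrow^3_l$: from $\Gamma,B\vdash\Delta;$ and $\Gamma'\vdash\Delta',A;\Pi$ infer $\Gamma,\Gamma',A\rightarrow B\vdash\Delta,\Delta';\Pi$. $\rightarrow^1_r$: from $\Gamma,A\vdash\Delta;B$ infer $\Gamma\vdash\Delta;A\rightarrow B$. $\rightarrow^2_r$: from $\Gamma,A\vdash\Delta,B;$ infer $\Gamma\vdash\Delta;A\rightarrow B$. One writes $\Gamma\vdash_{\mathcal P}\Delta;\Pi$ when the $\mathcal P$-sequent $\Gamma\vdash\Delta;\Pi$ is derivable in $\mathrm{ML}_{\mathcal P}$. -}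

module Defs where

open import Data.List using (List; []; _∷_; _++_; [_])
open import Data.List.Relation.Unary.All using (All)
open import Data.List.Relation.Unary.Any using (Any)
open import Data.List.Relation.Binary.Permutation.Propositional using (_↭_)
open import Data.Maybe using (Maybe; just; nothing)
import Data.Maybe.Relation.Unary.All as MAll
import Data.Maybe.Relation.Unary.Any as MAny
open import Data.Product using (_×_)
open import Data.Sum using (_⊎_)
open import Data.Unit using (⊤)
open import Relation.Nullary using (¬_)

data Formula (V : Set) : Set where
  `0   : Formula V
  `⊥   : Formula V
  var  : V → Formula V
  _∧_  : Formula V → Formula V → Formula V
  _∨_  : Formula V → Formula V → Formula V
  _⇒_  : Formula V → Formula V → Formula V

infixr 6 _∧_
infixr 5 _∨_
infixr 4 _⇒_

data _⊑_ {V : Set} (F : Formula V) : Formula V → Set where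
  ⊑-refl : F ⊑ F
  ⊑-∧ˡ : ∀ {A B} → F ⊑ A → F ⊑ (A ∧ B)
  ⊑-∧ʳ : ∀ {A B} → F ⊑ B → F ⊑ (A ∧ B)
  ⊑-∨ˡ : ∀ {A B} → F ⊑ A → F ⊑ (A ∨ B)
  ⊑-∨ʳ : ∀ {A B} → F ⊑ B → F ⊑ (A ∨ B)
  ⊑-⇒ˡ : ∀ {A B} → F ⊑ A → F ⊑ (A ⇒ B)
  ⊑-⇒ʳ : ∀ {A B} → F ⊑ B → F ⊑ (A ⇒ B)

-- Sequents Γ ⊢ Δ ; Π : multisets Γ, Δ are lists taken up to permutation
-- (explicit exchange rule `ex`), the stoup Π is a Maybe.
-- P is an arbitrary set (predicate) of formulas.
module _ {V : Set} (P : Formula V → Set) where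

  data ML : List (Formula V) → List (Formula V) → Maybe (Formula V) → Set where
    ex    : ∀ {Γ Γ' Δ Δ' Π} → Γ ↭ Γ' → Δ ↭ Δ' → ML Γ Δ Π → ML Γ' Δ' Π
    ax    : ∀ {A} → ML [ A ] [] (just A)
    cut₁  : ∀ {Γ Γ' Δ Δ' Π A} → ML Γ Δ (just A) → ML (A ∷ Γ') Δ' Π
          → ML (Γ ++ Γ') (Δ ++ Δ') Π
    cut₂  : ∀ {Γ Γ' Δ Δ' Π A} → ML Γ (A ∷ Δ) Π → ML (A ∷ Γ') Δ' nothing
          → ML (Γ ++ Γ') (Δ ++ Δ') Π
    der   : ∀ {Γ Δ A} → P A → ML Γ Δ (just A) → ML Γ (A ∷ Δ) nothing
    cₗ    : ∀ {Γ Δ Π A} → ML (A ∷ A ∷ Γ) Δ Π → ML (A ∷ Γ) Δ Π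
    cᵣ    : ∀ {Γ Δ Π A} → ML Γ (A ∷ A ∷ Δ) Π → ML Γ (A ∷ Δ) Π
    wₗ    : ∀ {Γ Δ Π A} → ML Γ Δ Π → ML (A ∷ Γ) Δ Π
    wᵣ    : ∀ {Γ Δ Π A} → P A → ML Γ Δ Π → ML Γ (A ∷ Δ) Π
    0-ax  : ∀ {Γ Δ Π} → All P Δ → ML (`0 ∷ Γ) Δ Π
    ⊥-ax  : ML [ `⊥ ] [] nothing
    ∧ₗ¹   : ∀ {Γ Δ A B C} → ¬ P A → ¬ P B → ML (A ∷ B ∷ Γ) Δ (just C)
          → ML ((A ∧ B) ∷ Γ) Δ (just C)
    ∧ₗ²   : ∀ {Γ Δ A B} → ML (A ∷ B ∷ Γ) Δ nothing → ML ((A ∧ B) ∷ Γ) Δ nothing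
    ∧ᵣ¹   : ∀ {Γ Γ' Δ Δ' A B} → ML Γ Δ (just A) → ML Γ' Δ' (just B)
          → ML (Γ ++ Γ') (Δ ++ Δ') (just (A ∧ B))
    ∧ᵣ²   : ∀ {Γ Γ' Δ Δ' A B} → ML Γ (A ∷ Δ) nothing → ML Γ' (B ∷ Δ') nothing
          → ML (Γ ++ Γ') (Δ ++ Δ') (just (A ∧ B))
    ∧ᵣ³   : ∀ {Γ Γ' Δ Δ' A B} → ML Γ Δ (just A) → ML Γ' (B ∷ Δ') nothing
          → ML (Γ ++ Γ') (Δ ++ Δ') (just (A ∧ B))
    ∧ᵣ⁴   : ∀ {Γ Γ' Δ Δ' A B} → ML Γ (A ∷ Δ) nothing → ML Γ' Δ' (just B)
          → ML (Γ ++ Γ') (Δ ++ Δ') (just (A ∧ B))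
    ∨ₗ¹   : ∀ {Γ Δ A B C} → ¬ P A → ¬ P B → ML (A ∷ Γ) Δ (just C) → ML (B ∷ Γ) Δ (just C)
          → ML ((A ∨ B) ∷ Γ) Δ (just C)
    ∨ₗ²   : ∀ {Γ Δ A B} → ML (A ∷ Γ) Δ nothing → ML (B ∷ Γ) Δ nothing
          → ML ((A ∨ B) ∷ Γ) Δ nothing
    ∨ᵣ¹   : ∀ {Γ Δ A B} → ML Γ Δ (just A) → ML Γ Δ (just (A ∨ B))
    ∨ᵣ²   : ∀ {Γ Δ A B} → ML Γ Δ (just B) → ML Γ Δ (just (A ∨ B))
    ∨ᵣ³   : ∀ {Γ Δ A B} → ML Γ (A ∷ Δ) nothing → ML Γ Δ (just (A ∨ B))
    ∨ᵣ⁴   : ∀ {Γ Δ A B} → ML Γ (B ∷ Δ) nothing → ML Γ Δ (just (A ∨ B))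
    ⇒ₗ¹   : ∀ {Γ Γ' Δ Δ' A B C} → ¬ P B → ML (B ∷ Γ) Δ (just C) → ML Γ' Δ' (just A)
          → ML ((A ⇒ B) ∷ (Γ ++ Γ')) (Δ ++ Δ') (just C)
    ⇒ₗ²   : ∀ {Γ Γ' Δ Δ' A B} → ML (B ∷ Γ) Δ nothing → ML Γ' Δ' (just A)
          → ML ((A ⇒ B) ∷ (Γ ++ Γ')) (Δ ++ Δ') nothing
    ⇒ₗ³   : ∀ {Γ Γ' Δ Δ' A B Π} → ML (B ∷ Γ) Δ nothing → ML Γ' (A ∷ Δ') Π
          → ML ((A ⇒ B) ∷ (Γ ++ Γ')) (Δ ++ Δ') Π
    ⇒ᵣ¹   : ∀ {Γ Δ A B} → ML (A ∷ Γ) Δ (just B) → ML Γ Δ (just (A ⇒ B))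
    ⇒ᵣ²   : ∀ {Γ Δ A B} → ML (A ∷ Γ) (B ∷ Δ) nothing → ML Γ Δ (just (A ⇒ B))

  PSequent : List (Formula V) → List (Formula V) → Maybe (Formula V) → Set
  PSequent Γ Δ Π = All P Δ

  SeqAll : (Formula V → Set) → List (Formula V) → List (Formula V) → Maybe (Formula V) → Set
  SeqAll Q Γ Δ Π = All Q Γ × All Q Δ × MAll.All Q Π

  OccAll : (Formula V → Set) → ∀ {Γ Δ Π} → ML Γ Δ Π → Set
  OccAll Q {Γ} {Δ} {Π} d = SeqAll Q Γ Δ Π × Prem d
    where
    Prem : ∀ {Γ Δ Π} → ML Γ Δ Π → Set
    Prem (ex _ _ d) = OccAll Q d
    Prem ax = ⊤
    Prem (cut₁ d e) = OccAll Q d × OccAll Q e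
    Prem (cut₂ d e) = OccAll Q d × OccAll Q e
    Prem (der _ d) = OccAll Q d
    Prem (cₗ d) = OccAll Q d
    Prem (cᵣ d) = OccAll Q d
    Prem (wₗ d) = OccAll Q d
    Prem (wᵣ _ d) = OccAll Q d
    Prem (0-ax _) = ⊤
    Prem ⊥-ax = ⊤
    Prem (∧ₗ¹ _ _ d) = OccAll Q d
    Prem (∧ₗ² d) = OccAll Q d
    Prem (∧ᵣ¹ d e) = OccAll Q d × OccAll Q e
    Prem (∧ᵣ² d e) = OccAll Q d × OccAll Q e
    Prem (∧ᵣ³ d e) = OccAll Q d × OccAll Q e
    Prem (∧ᵣ⁴ d e) = OccAll Q d × OccAll Q e
    Prem (∨ₗ¹ _ _ d e) = OccAll Q d × OccAll Q e
    Prem (∨ₗ² d e) = OccAll Q d × OccAll Q e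
    Prem (∨ᵣ¹ d) = OccAll Q d
    Prem (∨ᵣ² d) = OccAll Q d
    Prem (∨ᵣ³ d) = OccAll Q d
    Prem (∨ᵣ⁴ d) = OccAll Q d
    Prem (⇒ₗ¹ _ d e) = OccAll Q d × OccAll Q e
    Prem (⇒ₗ² d e) = OccAll Q d × OccAll Q e
    Prem (⇒ₗ³ d e) = OccAll Q d × OccAll Q e
    Prem (⇒ᵣ¹ d) = OccAll Q d
    Prem (⇒ᵣ² d) = OccAll Q d

  SubOfSeq : List (Formula V) → List (Formula V) → Maybe (Formula V) → Formula V → Set
  SubOfSeq Γ Δ Π F = Any (F ⊑_) Γ ⊎ Any (F ⊑_) Δ ⊎ MAny.Any (F ⊑_) Π

module Submission where

-- Cut elimination. A cut is eliminated by induction on the cut formula and then on the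
-- derivation of one premise. Since contraction is a rule, the cut has to remove every copy of
-- its formula at once; the copies are tracked by a set inclusion Γ' ⊆ A ∷ Θ rather than by
-- counting, which costs nothing because with exchange, weakening and contraction derivability
-- only depends on the underlying sets of formulas (⊢-resp-∼). Principal cuts reduce to cuts on
-- the immediate subformulas of the cut formula. Every rule other than cut only introduces
-- subformulas of its conclusion, so the resulting cut-free derivation has the subformula property.

open import Defs
open import Algebra.Bundles using (IdempotentCommutativeMonoid; CommutativeMonoid)
import Algebra.Solver.IdempotentCommutativeMonoid as ICMSolver
open import Data.Empty using (⊥-elim)
open import Data.List using (List; []; _∷_; _++_; [_])
open import Data.List.Properties using (++-assoc)
open import Data.List.Membership.Propositional using (_∈_)
open import Data.List.Membership.Propositional.Properties using (∈-∃++; ∈-++⁺ˡ; ∈-++⁺ʳ)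
open import Data.List.Relation.Binary.BagAndSetEquality
  using (_∼[_]_; set; commutativeMonoid; ++-idempotent; ∷-cong)
open import Data.List.Relation.Binary.Permutation.Propositional
  using (_↭_; ↭-refl; ↭-sym; ↭-reflexive; ↭-prep)
open import Data.List.Relation.Binary.Permutation.Propositional.Properties
  using (shift; ++-comm; ++⁺ʳ; All-resp-↭; ∈-resp-↭)
open import Data.List.Relation.Binary.Subset.Propositional using (_⊆_)
open import Data.List.Relation.Binary.Subset.Propositional.Properties
  using (⊆-refl; xs⊆xs++ys; ∈-∷⁺ʳ; All-resp-⊇)
open import Data.List.Relation.Unary.All as All using (All; []; _∷_)
open import Data.List.Relation.Unary.All.Properties using (++⁺; ++⁻ˡ; ++⁻ʳ)
open import Data.List.Relation.Unary.Any as Any using (here; there)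
open import Data.Maybe using (Maybe; just; nothing)
import Data.Maybe.Relation.Unary.All as MAll
import Data.Maybe.Relation.Unary.Any as MAny
open import Data.Product using (Σ; _,_; map; zip)
open import Data.Sum using (inj₁; inj₂)
open import Data.Unit using (⊤; tt)
open import Function using (_∘_)
open import Function.Bundles using (Equivalence)
open import Relation.Nullary using (¬_)
open import Relation.Binary.PropositionalEquality using (_≡_; refl; sym; subst)

⊑-trans : {V : Set} {A B C : Formula V} → A ⊑ B → B ⊑ C → A ⊑ C
⊑-trans p ⊑-refl = p
⊑-trans p (⊑-∧ˡ q) = ⊑-∧ˡ (⊑-trans p q)
⊑-trans p (⊑-∧ʳ q) = ⊑-∧ʳ (⊑-trans p q)
⊑-trans p (⊑-∨ˡ q) = ⊑-∨ˡ (⊑-trans p q)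
⊑-trans p (⊑-∨ʳ q) = ⊑-∨ʳ (⊑-trans p q)
⊑-trans p (⊑-⇒ˡ q) = ⊑-⇒ˡ (⊑-trans p q)
⊑-trans p (⊑-⇒ʳ q) = ⊑-⇒ʳ (⊑-trans p q)

SubformulaClosed : {V : Set} → (Formula V → Set) → Set
SubformulaClosed Q = ∀ {A B} → A ⊑ B → Q B → Q A

module _ {X : Set} where

  ∈⇒↭∷ : {x : X} {xs : List X} → x ∈ xs → Σ (List X) (λ ys → xs ↭ x ∷ ys)
  ∈⇒↭∷ x∈xs with ∈-∃++ x∈xs
  ... | ys , zs , refl = ys ++ zs , shift _ ys zs

  ∷-⊆-∷-∷ : {x y : X} {xs ys : List X} → xs ⊆ y ∷ ys → x ∷ xs ⊆ y ∷ x ∷ ys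
  ∷-⊆-∷-∷ xs⊆ (here refl) = there (here refl)
  ∷-⊆-∷-∷ xs⊆ (there z∈xs) with xs⊆ z∈xs
  ... | here z≡y = here z≡y
  ... | there z∈ys = there (there z∈ys)

  ++-setMonoid : IdempotentCommutativeMonoid _ _
  ++-setMonoid = record
    { isIdempotentCommutativeMonoid = record
      { isCommutativeMonoid = CommutativeMonoid.isCommutativeMonoid (commutativeMonoid set X)
      ; idem                = ++-idempotent
      }
    }

  open ICMSolver ++-setMonoid using (solve; _⊜_; _⊕_)
  open IdempotentCommutativeMonoid ++-setMonoid using () renaming (refl to ∼-refl)

  ++-absorbʳ : (xs ys : List X) → (xs ++ ys) ++ ys ∼[ set ] xs ++ ys
  ++-absorbʳ = solve 2 (λ xs ys → (xs ⊕ ys) ⊕ ys ⊜ xs ⊕ ys) ∼-refl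

  ++-merge : (xs ys zs : List X) → (xs ++ zs) ++ (ys ++ zs) ∼[ set ] (xs ++ ys) ++ zs
  ++-merge = solve 3 (λ xs ys zs → (xs ⊕ zs) ⊕ (ys ⊕ zs) ⊜ (xs ⊕ ys) ⊕ zs) ∼-refl

module _ {V : Set} (P : Formula V → Set) where

  private
    F = Formula V
    variable
      A B C : F
      Γ Γ' Δ Δ' Θ L L' M M' : List F
      Π : Maybe F

  open ICMSolver (++-setMonoid {X = F}) using (solve; _⊜_; _⊕_)
  open IdempotentCommutativeMonoid (++-setMonoid {X = F}) using () renaming (refl to ∼-refl)

  -- Side condition of the left rules: ∧ₗ¹, ∨ₗ¹, ⇒ₗ¹ allow a stoup formula only when the
  -- active formulas are not in P.
  Compatible : Maybe F → F → Set
  Compatible nothing  _ = ⊤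
  Compatible (just _) A = ¬ P A

  ¬P⇒Compatible : ¬ P A → Compatible Π A
  ¬P⇒Compatible {Π = nothing} _   = tt
  ¬P⇒Compatible {Π = just _}  ¬PA = ¬PA

  infix 3 _⊢_⨾_ _⊢_⨾⟨_⟩

  -- ML without cuts, the numbered variants of each logical rule merged into one;
  -- Γ ⊢ Δ ⨾⟨ A ⟩ derives A either in the stoup or in the body.
  data _⊢_⨾_ : List F → List F → Maybe F → Set
  data _⊢_⨾⟨_⟩ (Γ Δ : List F) (A : F) : Set

  data _⊢_⨾_ where
    ex    : Γ ↭ Γ' → Δ ↭ Δ' → Γ ⊢ Δ ⨾ Π → Γ' ⊢ Δ' ⨾ Π
    ax    : [ A ] ⊢ [] ⨾ just A
    der   : P A → Γ ⊢ Δ ⨾ just A → Γ ⊢ A ∷ Δ ⨾ nothing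
    cₗ    : A ∷ A ∷ Γ ⊢ Δ ⨾ Π → A ∷ Γ ⊢ Δ ⨾ Π
    cᵣ    : Γ ⊢ A ∷ A ∷ Δ ⨾ Π → Γ ⊢ A ∷ Δ ⨾ Π
    wₗ    : Γ ⊢ Δ ⨾ Π → A ∷ Γ ⊢ Δ ⨾ Π
    wᵣ    : P A → Γ ⊢ Δ ⨾ Π → Γ ⊢ A ∷ Δ ⨾ Π
    0-ax  : All P Δ → `0 ∷ Γ ⊢ Δ ⨾ Π
    ⊥-ax  : [ `⊥ ] ⊢ [] ⨾ nothing
    ∧ₗ    : Compatible Π A → Compatible Π B → A ∷ B ∷ Γ ⊢ Δ ⨾ Π → A ∧ B ∷ Γ ⊢ Δ ⨾ Π
    ∧ᵣ    : Γ ⊢ Δ ⨾⟨ A ⟩ → Γ' ⊢ Δ' ⨾⟨ B ⟩ → Γ ++ Γ' ⊢ Δ ++ Δ' ⨾ just (A ∧ B)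
    ∨ₗ    : Compatible Π A → Compatible Π B → A ∷ Γ ⊢ Δ ⨾ Π → B ∷ Γ ⊢ Δ ⨾ Π
          → (A ∨ B) ∷ Γ ⊢ Δ ⨾ Π
    ∨ᵣˡ   : Γ ⊢ Δ ⨾⟨ A ⟩ → Γ ⊢ Δ ⨾ just (A ∨ B)
    ∨ᵣʳ   : Γ ⊢ Δ ⨾⟨ B ⟩ → Γ ⊢ Δ ⨾ just (A ∨ B)
    ⇒ₗ    : Compatible Π B → B ∷ Γ ⊢ Δ ⨾ Π → Γ' ⊢ Δ' ⨾ just A
          → (A ⇒ B) ∷ Γ ++ Γ' ⊢ Δ ++ Δ' ⨾ Π
    ⇒ₗ′   : B ∷ Γ ⊢ Δ ⨾ nothing → Γ' ⊢ A ∷ Δ' ⨾ Π → (A ⇒ B) ∷ Γ ++ Γ' ⊢ Δ ++ Δ' ⨾ Π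
    ⇒ᵣ    : A ∷ Γ ⊢ Δ ⨾⟨ B ⟩ → Γ ⊢ Δ ⨾ just (A ⇒ B)

  data _⊢_⨾⟨_⟩ Γ Δ A where
    stoup : Γ ⊢ Δ ⨾ just A → Γ ⊢ Δ ⨾⟨ A ⟩
    body  : Γ ⊢ A ∷ Δ ⨾ nothing → Γ ⊢ Δ ⨾⟨ A ⟩

  body∈P : Γ ⊢ Δ ⨾ Π → All P Δ
  body∈P⟨⟩ : Γ ⊢ Δ ⨾⟨ A ⟩ → All P Δ

  body∈P (ex _ q d) = All-resp-↭ q (body∈P d)
  body∈P ax = []
  body∈P (der pA d) = pA ∷ body∈P d
  body∈P (cₗ d) = body∈P d
  body∈P (cᵣ d) = All.tail (body∈P d)
  body∈P (wₗ d) = body∈P d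
  body∈P (wᵣ pA d) = pA ∷ body∈P d
  body∈P (0-ax pΔ) = pΔ
  body∈P ⊥-ax = []
  body∈P (∧ₗ _ _ d) = body∈P d
  body∈P (∧ᵣ d e) = ++⁺ (body∈P⟨⟩ d) (body∈P⟨⟩ e)
  body∈P (∨ₗ _ _ d _) = body∈P d
  body∈P (∨ᵣˡ d) = body∈P⟨⟩ d
  body∈P (∨ᵣʳ d) = body∈P⟨⟩ d
  body∈P (⇒ₗ _ d e) = ++⁺ (body∈P d) (body∈P e)
  body∈P (⇒ₗ′ d e) = ++⁺ (body∈P d) (All.tail (body∈P e))
  body∈P (⇒ᵣ d) = body∈P⟨⟩ d

  body∈P⟨⟩ (stoup d) = body∈P d
  body∈P⟨⟩ (body d) = All.tail (body∈P d)

  wₗ* : ∀ Θ → Γ ⊢ Δ ⨾ Π → Θ ++ Γ ⊢ Δ ⨾ Π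
  wₗ* [] d = d
  wₗ* (_ ∷ Θ) d = wₗ (wₗ* Θ d)

  wᵣ* : All P Θ → Γ ⊢ Δ ⨾ Π → Γ ⊢ Θ ++ Δ ⨾ Π
  wᵣ* [] d = d
  wᵣ* (pA ∷ pΘ) d = wᵣ pA (wᵣ* pΘ d)

  cₗ-∈ : A ∈ Γ → A ∷ Γ ⊢ Δ ⨾ Π → Γ ⊢ Δ ⨾ Π
  cₗ-∈ A∈Γ d with _ , Γ↭A∷Γ₀ ← ∈⇒↭∷ A∈Γ =
    ex (↭-sym Γ↭A∷Γ₀) ↭-refl (cₗ (ex (↭-prep _ Γ↭A∷Γ₀) ↭-refl d))

  cᵣ-∈ : A ∈ Δ → Γ ⊢ A ∷ Δ ⨾ Π → Γ ⊢ Δ ⨾ Π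
  cᵣ-∈ A∈Δ d with _ , Δ↭A∷Δ₀ ← ∈⇒↭∷ A∈Δ =
    ex ↭-refl (↭-sym Δ↭A∷Δ₀) (cᵣ (ex ↭-refl (↭-prep _ Δ↭A∷Δ₀) d))

  ⊢-monoˡ : Γ ⊆ Γ' → Γ ⊢ Δ ⨾ Π → Γ' ⊢ Δ ⨾ Π
  ⊢-monoˡ {Γ = Γ} {Γ' = Γ'} Γ⊆Γ' d = absorb Γ Γ⊆Γ' (ex (++-comm Γ' Γ) ↭-refl (wₗ* Γ' d))
    where
    absorb : ∀ Θ → Θ ⊆ Γ' → Θ ++ Γ' ⊢ Δ ⨾ Π → Γ' ⊢ Δ ⨾ Π
    absorb [] _ d = d
    absorb (A ∷ Θ) A∷Θ⊆Γ' d =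
      absorb Θ (A∷Θ⊆Γ' ∘ there) (cₗ-∈ (∈-++⁺ʳ Θ (A∷Θ⊆Γ' (here refl))) d)

  ⊢-monoʳ : All P Δ' → Δ ⊆ Δ' → Γ ⊢ Δ ⨾ Π → Γ ⊢ Δ' ⨾ Π
  ⊢-monoʳ {Δ' = Δ'} {Δ = Δ} pΔ' Δ⊆Δ' d = absorb Δ Δ⊆Δ' (ex ↭-refl (++-comm Δ' Δ) (wᵣ* pΔ' d))
    where
    absorb : ∀ Θ → Θ ⊆ Δ' → Γ ⊢ Θ ++ Δ' ⨾ Π → Γ ⊢ Δ' ⨾ Π
    absorb [] _ d = d
    absorb (A ∷ Θ) A∷Θ⊆Δ' d =
      absorb Θ (A∷Θ⊆Δ' ∘ there) (cᵣ-∈ (∈-++⁺ʳ Θ (A∷Θ⊆Δ' (here refl))) d)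

  ⊢-mono : Γ ⊆ Γ' → All P Δ' → Δ ⊆ Δ' → Γ ⊢ Δ ⨾ Π → Γ' ⊢ Δ' ⨾ Π
  ⊢-mono Γ⊆Γ' pΔ' Δ⊆Δ' = ⊢-monoˡ Γ⊆Γ' ∘ ⊢-monoʳ pΔ' Δ⊆Δ'

  ⊢-resp-∼ : Γ ∼[ set ] Γ' → Δ ∼[ set ] Δ' → Γ ⊢ Δ ⨾ Π → Γ' ⊢ Δ' ⨾ Π
  ⊢-resp-∼ Γ∼Γ' Δ∼Δ' d =
    ⊢-mono (Equivalence.to Γ∼Γ') (All-resp-⊇ (Equivalence.from Δ∼Δ') (body∈P d))
           (Equivalence.to Δ∼Δ') d

  data Principal : List F → List F → F → Set where
    ∧ᵣ  : Γ ⊢ Δ ⨾⟨ A ⟩ → Γ' ⊢ Δ' ⨾⟨ B ⟩ → Principal (Γ ++ Γ') (Δ ++ Δ') (A ∧ B)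
    ∨ᵣˡ : Γ ⊢ Δ ⨾⟨ A ⟩ → Principal Γ Δ (A ∨ B)
    ∨ᵣʳ : Γ ⊢ Δ ⨾⟨ B ⟩ → Principal Γ Δ (A ∨ B)
    ⇒ᵣ  : A ∷ Γ ⊢ Δ ⨾⟨ B ⟩ → Principal Γ Δ (A ⇒ B)

  principal⇒⊢ : Principal Γ Δ A → Γ ⊢ Δ ⨾ just A
  principal⇒⊢ (∧ᵣ d e) = ∧ᵣ d e
  principal⇒⊢ (∨ᵣˡ d) = ∨ᵣˡ d
  principal⇒⊢ (∨ᵣʳ d) = ∨ᵣʳ d
  principal⇒⊢ (⇒ᵣ d) = ⇒ᵣ d

  ¬Principal-0 : ¬ Principal Γ Δ `0
  ¬Principal-0 ()

  ¬Principal-⊥ : ¬ Principal Γ Δ `⊥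
  ¬Principal-⊥ ()

  -- principal-cut removes every occurrence of A from the antecedent Γ' of its second premise,
  -- cut₂-admissible every occurrence of A from the body Δ of its first premise; Θ includes what
  -- remains.
  cut₁-admissible   : ∀ A → Γ ⊢ Δ ⨾ just A → A ∷ Γ' ⊢ Δ' ⨾ Π → Γ ++ Γ' ⊢ Δ ++ Δ' ⨾ Π
  cut₁-admissible⟨⟩ : ∀ A → Γ ⊢ Δ ⨾ just A → A ∷ Γ' ⊢ Δ' ⨾⟨ B ⟩ → Γ ++ Γ' ⊢ Δ ++ Δ' ⨾⟨ B ⟩
  cut₂-admissible   : ∀ A → All P Θ → Δ ⊆ A ∷ Θ → Γ ⊢ Δ ⨾ Π → A ∷ Γ' ⊢ Δ' ⨾ nothing
                    → Γ ++ Γ' ⊢ Θ ++ Δ' ⨾ Π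
  cut₂-admissible⟨⟩ : ∀ A → All P Θ → Δ ⊆ A ∷ Θ → Γ ⊢ Δ ⨾⟨ B ⟩ → A ∷ Γ' ⊢ Δ' ⨾ nothing
                    → Γ ++ Γ' ⊢ Θ ++ Δ' ⨾⟨ B ⟩
  principal-cut₁    : ∀ A → Principal Γ Δ A → A ∷ Γ' ⊢ Δ' ⨾ Π → Γ ++ Γ' ⊢ Δ ++ Δ' ⨾ Π
  principal-cut     : ∀ A → Principal Γ Δ A → Γ' ⊆ A ∷ Θ → Γ' ⊢ Δ' ⨾ Π → Θ ++ Γ ⊢ Δ' ++ Δ ⨾ Π
  principal-cut⟨⟩   : ∀ A → Principal Γ Δ A → Γ' ⊆ A ∷ Θ → Γ' ⊢ Δ' ⨾⟨ B ⟩ → Θ ++ Γ ⊢ Δ' ++ Δ ⨾⟨ B ⟩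
  cut⟨⟩             : ∀ A → Compatible Π A → Γ ⊢ Δ ⨾⟨ A ⟩ → A ∷ Γ' ⊢ Δ' ⨾ Π → Γ' ++ Γ ⊢ Δ' ++ Δ ⨾ Π
  -- The reductions take A together with an equation, rather than the instantiated formula,
  -- so that the cuts on B and C are seen by the termination checker to be on subterms of A.
  reduce-∧ : ∀ A → Principal Γ Δ A → B ∧ C ≡ A → Compatible Π B → Compatible Π C
           → B ∷ C ∷ L ⊢ M ⨾ Π → L ++ Γ ⊢ M ++ Δ ⨾ Π
  reduce-∨ : ∀ A → Principal Γ Δ A → B ∨ C ≡ A → Compatible Π B → Compatible Π C
           → B ∷ L ⊢ M ⨾ Π → C ∷ L ⊢ M ⨾ Π → L ++ Γ ⊢ M ++ Δ ⨾ Π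
  reduce-⇒ : ∀ A → Principal Γ Δ A → (B ⇒ C) ≡ A → Compatible Π C
           → C ∷ L ⊢ M ⨾ Π → L' ⊢ M' ⨾ just B → L ++ (L' ++ Γ) ⊢ M ++ (M' ++ Δ) ⨾ Π
  reduce-⇒′ : ∀ A → Principal Γ Δ A → (B ⇒ C) ≡ A
            → C ∷ L ⊢ M ⨾ nothing → L' ⊢ B ∷ M' ⨾ Π → L' ++ (L ++ Γ) ⊢ M' ++ (M ++ Δ) ⨾ Π

  cut₁-admissible A (ex q r d) e = ex (++⁺ʳ _ q) (++⁺ʳ _ r) (cut₁-admissible A d e)
  cut₁-admissible A ax e = e
  cut₁-admissible A (cₗ d) e = cₗ (cut₁-admissible A d e)
  cut₁-admissible A (cᵣ d) e = cᵣ (cut₁-admissible A d e)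
  cut₁-admissible A (wₗ d) e = wₗ (cut₁-admissible A d e)
  cut₁-admissible A (wᵣ pB d) e = wᵣ pB (cut₁-admissible A d e)
  cut₁-admissible A (0-ax pΔ) e = 0-ax (++⁺ pΔ (body∈P e))
  cut₁-admissible A (∧ₗ cB cC d) e =
    ∧ₗ (¬P⇒Compatible cB) (¬P⇒Compatible cC) (cut₁-admissible A d e)
  cut₁-admissible A (∨ₗ cB cC d₁ d₂) e =
    ∨ₗ (¬P⇒Compatible cB) (¬P⇒Compatible cC) (cut₁-admissible A d₁ e) (cut₁-admissible A d₂ e)
  cut₁-admissible {Γ' = Γ'} {Δ' = Δ'} A (⇒ₗ {Γ = Γ₁} {Δ = Δ₁} {Γ' = Γ₂} {Δ' = Δ₂} cC d₁ d₂) e =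
    ⊢-resp-∼ (∷-cong refl (swapʳ Γ₁ Γ₂ Γ')) (swapʳ Δ₁ Δ₂ Δ')
      (⇒ₗ (¬P⇒Compatible cC) (cut₁-admissible A d₁ e) d₂)
    where
    swapʳ : (xs ys zs : List F) → (xs ++ zs) ++ ys ∼[ set ] (xs ++ ys) ++ zs
    swapʳ = solve 3 (λ xs ys zs → (xs ⊕ zs) ⊕ ys ⊜ (xs ⊕ ys) ⊕ zs) ∼-refl
  cut₁-admissible {Γ' = Γ'} {Δ' = Δ'} A (⇒ₗ′ {Γ = Γ₁} {Δ = Δ₁} {Γ' = Γ₂} {Δ' = Δ₂} d₁ d₂) e =
    ex (↭-prep _ (↭-reflexive (sym (++-assoc Γ₁ Γ₂ Γ')))) (↭-reflexive (sym (++-assoc Δ₁ Δ₂ Δ')))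
      (⇒ₗ′ d₁ (cut₁-admissible A d₂ e))
  cut₁-admissible A (∧ᵣ d₁ d₂) e = principal-cut₁ A (∧ᵣ d₁ d₂) e
  cut₁-admissible A (∨ᵣˡ d) e = principal-cut₁ A (∨ᵣˡ d) e
  cut₁-admissible A (∨ᵣʳ d) e = principal-cut₁ A (∨ᵣʳ d) e
  cut₁-admissible A (⇒ᵣ d) e = principal-cut₁ A (⇒ᵣ d) e

  cut₁-admissible⟨⟩ A d (stoup e) = stoup (cut₁-admissible A d e)
  cut₁-admissible⟨⟩ {Δ = Δ} {Δ' = Δ'} {B = B} A d (body e) =
    body (ex ↭-refl (shift B Δ Δ') (cut₁-admissible A d e))

  cut₂-admissible A pΘ Δ⊆ (ex q r d) e =
    ex (++⁺ʳ _ q) ↭-refl (cut₂-admissible A pΘ (Δ⊆ ∘ ∈-resp-↭ r) d e)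
  cut₂-admissible A pΘ Δ⊆ ax e = ⊢-mono (xs⊆xs++ys _ _) (++⁺ pΘ (body∈P e)) (λ ()) ax
  cut₂-admissible {Θ = Θ} {Γ = Γ} {Γ' = Γ'} {Δ' = Δ'} A pΘ Δ⊆ (der pB d) e
    with ih ← cut₂-admissible A pΘ (Δ⊆ ∘ there) d e | Δ⊆ (here refl)
  ... | here B≡A =
    ⊢-resp-∼ (++-absorbʳ Γ Γ') (++-absorbʳ Θ Δ')
      (cut₁-admissible A (subst (λ B → Γ ++ Γ' ⊢ Θ ++ Δ' ⨾ just B) B≡A ih) e)
  ... | there B∈Θ = cᵣ-∈ (∈-++⁺ˡ B∈Θ) (der pB ih)
  cut₂-admissible A pΘ Δ⊆ (cₗ d) e = cₗ (cut₂-admissible A pΘ Δ⊆ d e)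
  cut₂-admissible A pΘ Δ⊆ (cᵣ d) e = cut₂-admissible A pΘ (Δ⊆ ∘ ∈-∷⁺ʳ (here refl) ⊆-refl) d e
  cut₂-admissible A pΘ Δ⊆ (wₗ d) e = wₗ (cut₂-admissible A pΘ Δ⊆ d e)
  cut₂-admissible A pΘ Δ⊆ (wᵣ _ d) e = cut₂-admissible A pΘ (Δ⊆ ∘ there) d e
  cut₂-admissible A pΘ Δ⊆ (0-ax _) e = 0-ax (++⁺ pΘ (body∈P e))
  cut₂-admissible A pΘ Δ⊆ ⊥-ax e = ⊢-mono (xs⊆xs++ys _ _) (++⁺ pΘ (body∈P e)) (λ ()) ⊥-ax
  cut₂-admissible A pΘ Δ⊆ (∧ₗ cB cC d) e = ∧ₗ cB cC (cut₂-admissible A pΘ Δ⊆ d e)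
  cut₂-admissible A pΘ Δ⊆ (∨ₗ cB cC d₁ d₂) e =
    ∨ₗ cB cC (cut₂-admissible A pΘ Δ⊆ d₁ e) (cut₂-admissible A pΘ Δ⊆ d₂ e)
  cut₂-admissible {Θ = Θ} {Γ' = Γ'} {Δ' = Δ'} A pΘ Δ⊆ (∧ᵣ {Γ = Γ₁} {Δ = Δ₁} {Γ' = Γ₂} d₁ d₂) e =
    ⊢-resp-∼ (++-merge Γ₁ Γ₂ Γ') (++-idempotent (Θ ++ Δ'))
      (∧ᵣ (cut₂-admissible⟨⟩ A pΘ (Δ⊆ ∘ ∈-++⁺ˡ) d₁ e)
          (cut₂-admissible⟨⟩ A pΘ (Δ⊆ ∘ ∈-++⁺ʳ Δ₁) d₂ e))
  cut₂-admissible A pΘ Δ⊆ (∨ᵣˡ d) e = ∨ᵣˡ (cut₂-admissible⟨⟩ A pΘ Δ⊆ d e)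
  cut₂-admissible A pΘ Δ⊆ (∨ᵣʳ d) e = ∨ᵣʳ (cut₂-admissible⟨⟩ A pΘ Δ⊆ d e)
  cut₂-admissible {Θ = Θ} {Γ' = Γ'} {Δ' = Δ'} A pΘ Δ⊆ (⇒ₗ {Γ = Γ₁} {Δ = Δ₁} {Γ' = Γ₂} cC d₁ d₂) e =
    ⊢-resp-∼ (∷-cong refl (++-merge Γ₁ Γ₂ Γ')) (++-idempotent (Θ ++ Δ'))
      (⇒ₗ cC (cut₂-admissible A pΘ (Δ⊆ ∘ ∈-++⁺ˡ) d₁ e) (cut₂-admissible A pΘ (Δ⊆ ∘ ∈-++⁺ʳ Δ₁) d₂ e))
  cut₂-admissible {Θ = Θ} {Γ' = Γ'} {Δ' = Δ'} A pΘ Δ⊆ (⇒ₗ′ {Γ = Γ₁} {Δ = Δ₁} {Γ' = Γ₂} d₁ d₂) e =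
    ⊢-resp-∼ (∷-cong refl (++-merge Γ₁ Γ₂ Γ')) (++-idempotent (Θ ++ Δ'))
      (⇒ₗ′ (cut₂-admissible A pΘ (Δ⊆ ∘ ∈-++⁺ˡ) d₁ e)
           (cut₂-admissible A (All.head (body∈P d₂) ∷ pΘ) (∷-⊆-∷-∷ (Δ⊆ ∘ ∈-++⁺ʳ Δ₁)) d₂ e))
  cut₂-admissible A pΘ Δ⊆ (⇒ᵣ d) e = ⇒ᵣ (cut₂-admissible⟨⟩ A pΘ Δ⊆ d e)

  cut₂-admissible⟨⟩ A pΘ Δ⊆ (stoup d) e = stoup (cut₂-admissible A pΘ Δ⊆ d e)
  cut₂-admissible⟨⟩ A pΘ Δ⊆ (body d) e =
    body (cut₂-admissible A (All.head (body∈P d) ∷ pΘ) (∷-⊆-∷-∷ Δ⊆) d e)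

  principal-cut₁ {Γ = Γ} {Δ = Δ} {Γ' = Γ'} {Δ' = Δ'} A p e =
    ex (++-comm Γ' Γ) (++-comm Δ' Δ) (principal-cut A p ⊆-refl e)

  principal-cut A p Γ'⊆ (ex q r e) =
    ex ↭-refl (++⁺ʳ _ r) (principal-cut A p (Γ'⊆ ∘ ∈-resp-↭ q) e)
  principal-cut A p Γ'⊆ ax with Γ'⊆ (here refl)
  ... | here refl = wₗ* _ (principal⇒⊢ p)
  ... | there B∈Θ =
    ⊢-mono (∈-∷⁺ʳ (∈-++⁺ˡ B∈Θ) (λ ())) (body∈P (principal⇒⊢ p)) (λ ()) ax
  principal-cut A p Γ'⊆ (der pB e) = der pB (principal-cut A p Γ'⊆ e)
  principal-cut A p Γ'⊆ (cₗ e) = principal-cut A p (Γ'⊆ ∘ ∈-∷⁺ʳ (here refl) ⊆-refl) e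
  principal-cut A p Γ'⊆ (cᵣ e) = cᵣ (principal-cut A p Γ'⊆ e)
  principal-cut A p Γ'⊆ (wₗ e) = principal-cut A p (Γ'⊆ ∘ there) e
  principal-cut A p Γ'⊆ (wᵣ pB e) = wᵣ pB (principal-cut A p Γ'⊆ e)
  principal-cut A p Γ'⊆ (0-ax pΔ') with Γ'⊆ (here refl)
  ... | here refl = ⊥-elim (¬Principal-0 p)
  ... | there 0∈Θ = cₗ-∈ (∈-++⁺ˡ 0∈Θ) (0-ax (++⁺ pΔ' (body∈P (principal⇒⊢ p))))
  principal-cut A p Γ'⊆ ⊥-ax with Γ'⊆ (here refl)
  ... | here refl = ⊥-elim (¬Principal-⊥ p)
  ... | there ⊥∈Θ =
    ⊢-mono (∈-∷⁺ʳ (∈-++⁺ˡ ⊥∈Θ) (λ ())) (body∈P (principal⇒⊢ p)) (λ ()) ⊥-ax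
  principal-cut {Γ = Γ} {Δ = Δ} {Θ = Θ} {Δ' = Δ'} A p Γ'⊆ (∧ₗ cB cC e)
    with r ← principal-cut A p (∷-⊆-∷-∷ (∷-⊆-∷-∷ (Γ'⊆ ∘ there))) e | Γ'⊆ (here refl)
  ... | here B∧C≡A = ⊢-resp-∼ (++-absorbʳ Θ Γ) (++-absorbʳ Δ' Δ) (reduce-∧ A p B∧C≡A cB cC r)
  ... | there B∧C∈Θ = cₗ-∈ (∈-++⁺ˡ B∧C∈Θ) (∧ₗ cB cC r)
  principal-cut {Γ = Γ} {Δ = Δ} {Θ = Θ} A p Γ'⊆ (∧ᵣ {Γ = Γ₁} {Δ = Δ₁} {Δ' = Δ₂} e₁ e₂) =
    ⊢-resp-∼ (++-idempotent (Θ ++ Γ)) (++-merge Δ₁ Δ₂ Δ)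
      (∧ᵣ (principal-cut⟨⟩ A p (Γ'⊆ ∘ ∈-++⁺ˡ) e₁) (principal-cut⟨⟩ A p (Γ'⊆ ∘ ∈-++⁺ʳ Γ₁) e₂))
  principal-cut {Γ = Γ} {Δ = Δ} {Θ = Θ} {Δ' = Δ'} A p Γ'⊆ (∨ₗ cB cC e₁ e₂)
    with r₁ ← principal-cut A p (∷-⊆-∷-∷ (Γ'⊆ ∘ there)) e₁
       | r₂ ← principal-cut A p (∷-⊆-∷-∷ (Γ'⊆ ∘ there)) e₂
       | Γ'⊆ (here refl)
  ... | here B∨C≡A = ⊢-resp-∼ (++-absorbʳ Θ Γ) (++-absorbʳ Δ' Δ) (reduce-∨ A p B∨C≡A cB cC r₁ r₂)
  ... | there B∨C∈Θ = cₗ-∈ (∈-++⁺ˡ B∨C∈Θ) (∨ₗ cB cC r₁ r₂)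
  principal-cut A p Γ'⊆ (∨ᵣˡ e) = ∨ᵣˡ (principal-cut⟨⟩ A p Γ'⊆ e)
  principal-cut A p Γ'⊆ (∨ᵣʳ e) = ∨ᵣʳ (principal-cut⟨⟩ A p Γ'⊆ e)
  principal-cut {Γ = Γ} {Δ = Δ} {Θ = Θ} A p Γ'⊆ (⇒ₗ {Γ = Γ₁} {Δ = Δ₁} {Δ' = Δ₂} cC e₁ e₂)
    with r₁ ← principal-cut A p (∷-⊆-∷-∷ (Γ'⊆ ∘ there ∘ ∈-++⁺ˡ)) e₁
       | r₂ ← principal-cut A p (Γ'⊆ ∘ there ∘ ∈-++⁺ʳ Γ₁) e₂
       | Γ'⊆ (here refl)
  ... | here B⇒C≡A =
    ⊢-resp-∼ (solve 2 (λ t g → (t ⊕ g) ⊕ ((t ⊕ g) ⊕ g) ⊜ t ⊕ g) ∼-refl Θ Γ)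
             (solve 3 (λ a b d → (a ⊕ d) ⊕ ((b ⊕ d) ⊕ d) ⊜ (a ⊕ b) ⊕ d) ∼-refl Δ₁ Δ₂ Δ)
             (reduce-⇒ A p B⇒C≡A cC r₁ r₂)
  ... | there B⇒C∈Θ =
    cₗ-∈ (∈-++⁺ˡ B⇒C∈Θ)
      (⊢-resp-∼ (∷-cong refl (++-idempotent (Θ ++ Γ))) (++-merge Δ₁ Δ₂ Δ) (⇒ₗ cC r₁ r₂))
  principal-cut {Γ = Γ} {Δ = Δ} {Θ = Θ} A p Γ'⊆ (⇒ₗ′ {Γ = Γ₁} {Δ = Δ₁} {Δ' = Δ₂} e₁ e₂)
    with r₁ ← principal-cut A p (∷-⊆-∷-∷ (Γ'⊆ ∘ there ∘ ∈-++⁺ˡ)) e₁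
       | r₂ ← principal-cut A p (Γ'⊆ ∘ there ∘ ∈-++⁺ʳ Γ₁) e₂
       | Γ'⊆ (here refl)
  ... | here B⇒C≡A =
    ⊢-resp-∼ (solve 2 (λ t g → (t ⊕ g) ⊕ ((t ⊕ g) ⊕ g) ⊜ t ⊕ g) ∼-refl Θ Γ)
             (solve 3 (λ a b d → (b ⊕ d) ⊕ ((a ⊕ d) ⊕ d) ⊜ (a ⊕ b) ⊕ d) ∼-refl Δ₁ Δ₂ Δ)
             (reduce-⇒′ A p B⇒C≡A r₁ r₂)
  ... | there B⇒C∈Θ =
    cₗ-∈ (∈-++⁺ˡ B⇒C∈Θ)
      (⊢-resp-∼ (∷-cong refl (++-idempotent (Θ ++ Γ))) (++-merge Δ₁ Δ₂ Δ) (⇒ₗ′ r₁ r₂))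
  principal-cut A p Γ'⊆ (⇒ᵣ e) = ⇒ᵣ (principal-cut⟨⟩ A p (∷-⊆-∷-∷ Γ'⊆) e)

  principal-cut⟨⟩ A p Γ'⊆ (stoup e) = stoup (principal-cut A p Γ'⊆ e)
  principal-cut⟨⟩ A p Γ'⊆ (body e) = body (principal-cut A p Γ'⊆ e)

  cut⟨⟩ {Γ = Γ} {Δ = Δ} {Γ' = Γ'} {Δ' = Δ'} A _ (stoup d) e =
    ex (++-comm Γ Γ') (++-comm Δ Δ') (cut₁-admissible A d e)
  cut⟨⟩ {Π = nothing} {Γ = Γ} {Δ = Δ} {Γ' = Γ'} {Δ' = Δ'} A _ (body d) e =
    ex (++-comm Γ Γ') (++-comm Δ Δ') (cut₂-admissible A (All.tail (body∈P d)) ⊆-refl d e)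
  cut⟨⟩ {Π = just _} A ¬PA (body d) e = ⊥-elim (¬PA (All.head (body∈P d)))

  reduce-∧ {L = L} {M = M} (B ∧ C) (∧ᵣ {Γ = Γ₁} {Δ = Δ₁} {Γ' = Γ₂} {Δ' = Δ₂} p₁ p₂) refl cB cC r =
    ex (↭-reflexive (++-assoc L Γ₁ Γ₂)) (↭-reflexive (++-assoc M Δ₁ Δ₂))
      (cut⟨⟩ C cC p₂ (cut⟨⟩ B cB p₁ r))

  reduce-∨ (B ∨ C) (∨ᵣˡ p₁) refl cB cC r₁ r₂ = cut⟨⟩ B cB p₁ r₁
  reduce-∨ (B ∨ C) (∨ᵣʳ p₂) refl cB cC r₁ r₂ = cut⟨⟩ C cC p₂ r₂

  reduce-⇒ (B ⇒ C) (⇒ᵣ p) refl cC r₁ r₂ = cut⟨⟩ C cC (cut₁-admissible⟨⟩ B r₂ p) r₁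

  reduce-⇒′ {Γ = Γ} {L = L} (B ⇒ C) (⇒ᵣ p) refl r₁ r₂ =
    cut₂-admissible B (All.tail (body∈P r₂)) ⊆-refl r₂ (ex (shift B L Γ) ↭-refl (cut⟨⟩ C tt p r₁))

  cut-elimination : ML P Γ Δ Π → Γ ⊢ Δ ⨾ Π
  cut-elimination (ex p q d) = ex p q (cut-elimination d)
  cut-elimination ax = ax
  cut-elimination (cut₁ {A = A} d e) = cut₁-admissible A (cut-elimination d) (cut-elimination e)
  cut-elimination (cut₂ {A = A} d e) =
    cut₂-admissible A (All.tail (body∈P d′)) ⊆-refl d′ (cut-elimination e)
    where d′ = cut-elimination d
  cut-elimination (der pA d) = der pA (cut-elimination d)
  cut-elimination (cₗ d) = cₗ (cut-elimination d)
  cut-elimination (cᵣ d) = cᵣ (cut-elimination d)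
  cut-elimination (wₗ d) = wₗ (cut-elimination d)
  cut-elimination (wᵣ pA d) = wᵣ pA (cut-elimination d)
  cut-elimination (0-ax pΔ) = 0-ax pΔ
  cut-elimination ⊥-ax = ⊥-ax
  cut-elimination (∧ₗ¹ ¬PA ¬PB d) = ∧ₗ ¬PA ¬PB (cut-elimination d)
  cut-elimination (∧ₗ² d) = ∧ₗ tt tt (cut-elimination d)
  cut-elimination (∧ᵣ¹ d e) = ∧ᵣ (stoup (cut-elimination d)) (stoup (cut-elimination e))
  cut-elimination (∧ᵣ² d e) = ∧ᵣ (body (cut-elimination d)) (body (cut-elimination e))
  cut-elimination (∧ᵣ³ d e) = ∧ᵣ (stoup (cut-elimination d)) (body (cut-elimination e))
  cut-elimination (∧ᵣ⁴ d e) = ∧ᵣ (body (cut-elimination d)) (stoup (cut-elimination e))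
  cut-elimination (∨ₗ¹ ¬PA ¬PB d e) = ∨ₗ ¬PA ¬PB (cut-elimination d) (cut-elimination e)
  cut-elimination (∨ₗ² d e) = ∨ₗ tt tt (cut-elimination d) (cut-elimination e)
  cut-elimination (∨ᵣ¹ d) = ∨ᵣˡ (stoup (cut-elimination d))
  cut-elimination (∨ᵣ² d) = ∨ᵣʳ (stoup (cut-elimination d))
  cut-elimination (∨ᵣ³ d) = ∨ᵣˡ (body (cut-elimination d))
  cut-elimination (∨ᵣ⁴ d) = ∨ᵣʳ (body (cut-elimination d))
  cut-elimination (⇒ₗ¹ ¬PB d e) = ⇒ₗ ¬PB (cut-elimination d) (cut-elimination e)
  cut-elimination (⇒ₗ² d e) = ⇒ₗ tt (cut-elimination d) (cut-elimination e)
  cut-elimination (⇒ₗ³ d e) = ⇒ₗ′ (cut-elimination d) (cut-elimination e)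
  cut-elimination (⇒ᵣ¹ d) = ⇒ᵣ (stoup (cut-elimination d))
  cut-elimination (⇒ᵣ² d) = ⇒ᵣ (body (cut-elimination d))

  module _ {Q : F → Set} (closed : SubformulaClosed Q) where

    private
      immediate : (A ⊑ A → A ⊑ B) → Q B → Q A
      immediate step = closed (step ⊑-refl)

    subformula-property : Γ ⊢ Δ ⨾ Π → SeqAll P Q Γ Δ Π → Σ (ML P Γ Δ Π) (OccAll P Q)
    subformula-property (ex p q d) s@(qΓ , qΔ , qΠ) =
      map (ex p q) (s ,_)
        (subformula-property d (All-resp-↭ (↭-sym p) qΓ , All-resp-↭ (↭-sym q) qΔ , qΠ))
    subformula-property ax s = ax , s , tt
    subformula-property (der pA d) s@(qΓ , qA ∷ qΔ , _) =
      map (der pA) (s ,_) (subformula-property d (qΓ , qΔ , MAll.just qA))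
    subformula-property (cₗ d) s@(qA ∷ qΓ , qΔ , qΠ) =
      map cₗ (s ,_) (subformula-property d (qA ∷ qA ∷ qΓ , qΔ , qΠ))
    subformula-property (cᵣ d) s@(qΓ , qA ∷ qΔ , qΠ) =
      map cᵣ (s ,_) (subformula-property d (qΓ , qA ∷ qA ∷ qΔ , qΠ))
    subformula-property (wₗ d) s@(_ ∷ qΓ , qΔ , qΠ) =
      map wₗ (s ,_) (subformula-property d (qΓ , qΔ , qΠ))
    subformula-property (wᵣ pA d) s@(qΓ , _ ∷ qΔ , qΠ) =
      map (wᵣ pA) (s ,_) (subformula-property d (qΓ , qΔ , qΠ))
    subformula-property (0-ax pΔ) s = 0-ax pΔ , s , tt
    subformula-property ⊥-ax s = ⊥-ax , s , tt
    subformula-property (∧ₗ {Π = nothing} _ _ d) s@(qA∧B ∷ qΓ , qΔ , qΠ) =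
      map ∧ₗ² (s ,_)
        (subformula-property d (immediate ⊑-∧ˡ qA∧B ∷ immediate ⊑-∧ʳ qA∧B ∷ qΓ , qΔ , qΠ))
    subformula-property (∧ₗ {Π = just _} ¬PA ¬PB d) s@(qA∧B ∷ qΓ , qΔ , qΠ) =
      map (∧ₗ¹ ¬PA ¬PB) (s ,_)
        (subformula-property d (immediate ⊑-∧ˡ qA∧B ∷ immediate ⊑-∧ʳ qA∧B ∷ qΓ , qΔ , qΠ))
    subformula-property (∧ᵣ {Γ = Γ₁} {Δ = Δ₁} (stoup d) (stoup e)) s@(qΓ , qΔ , MAll.just qA∧B) =
      zip ∧ᵣ¹ (λ o o′ → s , o , o′)
        (subformula-property d (++⁻ˡ Γ₁ qΓ , ++⁻ˡ Δ₁ qΔ , MAll.just (immediate ⊑-∧ˡ qA∧B)))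
        (subformula-property e (++⁻ʳ Γ₁ qΓ , ++⁻ʳ Δ₁ qΔ , MAll.just (immediate ⊑-∧ʳ qA∧B)))
    subformula-property (∧ᵣ {Γ = Γ₁} {Δ = Δ₁} (body d) (body e)) s@(qΓ , qΔ , MAll.just qA∧B) =
      zip ∧ᵣ² (λ o o′ → s , o , o′)
        (subformula-property d (++⁻ˡ Γ₁ qΓ , immediate ⊑-∧ˡ qA∧B ∷ ++⁻ˡ Δ₁ qΔ , MAll.nothing))
        (subformula-property e (++⁻ʳ Γ₁ qΓ , immediate ⊑-∧ʳ qA∧B ∷ ++⁻ʳ Δ₁ qΔ , MAll.nothing))
    subformula-property (∧ᵣ {Γ = Γ₁} {Δ = Δ₁} (stoup d) (body e)) s@(qΓ , qΔ , MAll.just qA∧B) =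
      zip ∧ᵣ³ (λ o o′ → s , o , o′)
        (subformula-property d (++⁻ˡ Γ₁ qΓ , ++⁻ˡ Δ₁ qΔ , MAll.just (immediate ⊑-∧ˡ qA∧B)))
        (subformula-property e (++⁻ʳ Γ₁ qΓ , immediate ⊑-∧ʳ qA∧B ∷ ++⁻ʳ Δ₁ qΔ , MAll.nothing))
    subformula-property (∧ᵣ {Γ = Γ₁} {Δ = Δ₁} (body d) (stoup e)) s@(qΓ , qΔ , MAll.just qA∧B) =
      zip ∧ᵣ⁴ (λ o o′ → s , o , o′)
        (subformula-property d (++⁻ˡ Γ₁ qΓ , immediate ⊑-∧ˡ qA∧B ∷ ++⁻ˡ Δ₁ qΔ , MAll.nothing))
        (subformula-property e (++⁻ʳ Γ₁ qΓ , ++⁻ʳ Δ₁ qΔ , MAll.just (immediate ⊑-∧ʳ qA∧B)))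
    subformula-property (∨ₗ {Π = nothing} _ _ d e) s@(qA∨B ∷ qΓ , qΔ , qΠ) =
      zip ∨ₗ² (λ o o′ → s , o , o′)
        (subformula-property d (immediate ⊑-∨ˡ qA∨B ∷ qΓ , qΔ , qΠ))
        (subformula-property e (immediate ⊑-∨ʳ qA∨B ∷ qΓ , qΔ , qΠ))
    subformula-property (∨ₗ {Π = just _} ¬PA ¬PB d e) s@(qA∨B ∷ qΓ , qΔ , qΠ) =
      zip (∨ₗ¹ ¬PA ¬PB) (λ o o′ → s , o , o′)
        (subformula-property d (immediate ⊑-∨ˡ qA∨B ∷ qΓ , qΔ , qΠ))
        (subformula-property e (immediate ⊑-∨ʳ qA∨B ∷ qΓ , qΔ , qΠ))
    subformula-property (∨ᵣˡ (stoup d)) s@(qΓ , qΔ , MAll.just qA∨B) =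
      map ∨ᵣ¹ (s ,_) (subformula-property d (qΓ , qΔ , MAll.just (immediate ⊑-∨ˡ qA∨B)))
    subformula-property (∨ᵣˡ (body d)) s@(qΓ , qΔ , MAll.just qA∨B) =
      map ∨ᵣ³ (s ,_) (subformula-property d (qΓ , immediate ⊑-∨ˡ qA∨B ∷ qΔ , MAll.nothing))
    subformula-property (∨ᵣʳ (stoup d)) s@(qΓ , qΔ , MAll.just qA∨B) =
      map ∨ᵣ² (s ,_) (subformula-property d (qΓ , qΔ , MAll.just (immediate ⊑-∨ʳ qA∨B)))
    subformula-property (∨ᵣʳ (body d)) s@(qΓ , qΔ , MAll.just qA∨B) =
      map ∨ᵣ⁴ (s ,_) (subformula-property d (qΓ , immediate ⊑-∨ʳ qA∨B ∷ qΔ , MAll.nothing))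
    subformula-property (⇒ₗ {Π = nothing} {Γ = Γ₁} {Δ = Δ₁} _ d e) s@(qA⇒B ∷ qΓ , qΔ , qΠ) =
      zip ⇒ₗ² (λ o o′ → s , o , o′)
        (subformula-property d (immediate ⊑-⇒ʳ qA⇒B ∷ ++⁻ˡ Γ₁ qΓ , ++⁻ˡ Δ₁ qΔ , qΠ))
        (subformula-property e (++⁻ʳ Γ₁ qΓ , ++⁻ʳ Δ₁ qΔ , MAll.just (immediate ⊑-⇒ˡ qA⇒B)))
    subformula-property (⇒ₗ {Π = just _} {Γ = Γ₁} {Δ = Δ₁} ¬PB d e) s@(qA⇒B ∷ qΓ , qΔ , qΠ) =
      zip (⇒ₗ¹ ¬PB) (λ o o′ → s , o , o′)
        (subformula-property d (immediate ⊑-⇒ʳ qA⇒B ∷ ++⁻ˡ Γ₁ qΓ , ++⁻ˡ Δ₁ qΔ , qΠ))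
        (subformula-property e (++⁻ʳ Γ₁ qΓ , ++⁻ʳ Δ₁ qΔ , MAll.just (immediate ⊑-⇒ˡ qA⇒B)))
    subformula-property (⇒ₗ′ {Γ = Γ₁} {Δ = Δ₁} d e) s@(qA⇒B ∷ qΓ , qΔ , qΠ) =
      zip ⇒ₗ³ (λ o o′ → s , o , o′)
        (subformula-property d (immediate ⊑-⇒ʳ qA⇒B ∷ ++⁻ˡ Γ₁ qΓ , ++⁻ˡ Δ₁ qΔ , MAll.nothing))
        (subformula-property e (++⁻ʳ Γ₁ qΓ , immediate ⊑-⇒ˡ qA⇒B ∷ ++⁻ʳ Δ₁ qΔ , qΠ))
    subformula-property (⇒ᵣ (stoup d)) s@(qΓ , qΔ , MAll.just qA⇒B) =
      map ⇒ᵣ¹ (s ,_)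
        (subformula-property d (immediate ⊑-⇒ˡ qA⇒B ∷ qΓ , qΔ , MAll.just (immediate ⊑-⇒ʳ qA⇒B)))
    subformula-property (⇒ᵣ (body d)) s@(qΓ , qΔ , MAll.just qA⇒B) =
      map ⇒ᵣ² (s ,_)
        (subformula-property d (immediate ⊑-⇒ˡ qA⇒B ∷ qΓ , immediate ⊑-⇒ʳ qA⇒B ∷ qΔ , MAll.nothing))

  SubOfSeq-closed : SubformulaClosed (SubOfSeq P Γ Δ Π)
  SubOfSeq-closed A⊑B (inj₁ B⊑Γ) = inj₁ (Any.map (⊑-trans A⊑B) B⊑Γ)
  SubOfSeq-closed A⊑B (inj₂ (inj₁ B⊑Δ)) = inj₂ (inj₁ (Any.map (⊑-trans A⊑B) B⊑Δ))
  SubOfSeq-closed A⊑B (inj₂ (inj₂ B⊑Π)) = inj₂ (inj₂ (MAny.map (⊑-trans A⊑B) B⊑Π))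

  SeqAll-SubOfSeq : ∀ Γ Δ Π → SeqAll P (SubOfSeq P Γ Δ Π) Γ Δ Π
  SeqAll-SubOfSeq Γ Δ Π =
    All.tabulate (inj₁ ∘ Any.map ≡⇒⊑) , All.tabulate (inj₂ ∘ inj₁ ∘ Any.map ≡⇒⊑) ,
    MAll.map (inj₂ ∘ inj₂) (stoup⊑ Π)
    where
    ≡⇒⊑ : A ≡ B → A ⊑ B
    ≡⇒⊑ refl = ⊑-refl
    stoup⊑ : ∀ Π → MAll.All (λ A → MAny.Any (A ⊑_) Π) Π
    stoup⊑ nothing = MAll.nothing
    stoup⊑ (just A) = MAll.just (MAny.just ⊑-refl)

corollary3p2 : {V : Set} (P : Formula V → Set)
    (Γ Δ : List (Formula V)) (Π : Maybe (Formula V))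
    → PSequent P Γ Δ Π
    → (d : ML P Γ Δ Π)
    → Σ (ML P Γ Δ Π) (λ d′ → OccAll P (SubOfSeq P Γ Δ Π) d′)
corollary3p2 P Γ Δ Π _ d =
  subformula-property P (SubOfSeq-closed P) (cut-elimination P d) (SeqAll-SubOfSeq P Γ Δ Π)
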